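{- CPG (CCS with priority guards) is not replacement free: there exist a context $C$, a closed invisible process $I$ and a process $P$ of CPG such that $C[I]\Downarrow$ but not $C[P]\Downarrow$.
   Context: CPG is Phillips' CCS with Priority Guards, with syntax $P ::= 0 \mid \sum_{i\in I} S_i:\mu_i.P_i \mid P[f] \mid P\backslash L \mid P\mid Q \mid A\langle a_1,\dots,a_n\rangle$, where each $S_i$ is a finite set of visible actions; $S:\mu.P$ behaves like $\mu.P$ except that $\mu$ can only be performed if the environment does not offer any action in $\overline S=\{\overline n \mid n\in S\}$. Transitions are labelled $S:\mu$, meaning the action $\mu$ can be performed provided the environment offers no $\overline\alpha$ with $\alpha\in S$; a label $S:\mu$ is visible iff $\mu\neq\tau$. The semantics is Phillips' standard labelled transition semantics for CPG. A process is closed if it has no free names. A context is a term with one hole; $C[P]$ is hole filling. $\Rightarrow$ is the reflexive-transitive closure of invisible transitions; $P\Downarrow$ iff $P$ can reach, via invisible transitions, a visible transition; $P$ is invisible iff not $P\Downarrow$. A calculus is replacement free if for every context $C$, closed invisible process $I$ and process $P$, $C[I]\Downarrow$ implies $C[P]\Downarrow$. -}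

module Defs where

open import Data.Nat using (ℕ; _≟_)
open import Data.List using (List; []; _∷_; _++_; map; filter)
open import Data.List.Relation.Unary.Any using (Any)
open import Data.List.Membership.Propositional using (_∈_; _∉_)
open import Data.List.Membership.DecPropositional _≟_ using (_∈?_)
open import Data.Product using (Σ; ∃; ∃-syntax; _×_; _,_)
open import Data.Sum using (_⊎_)
open import Data.Empty using (⊥)
open import Relation.Nullary using (¬_; ¬?)
open import Relation.Binary.PropositionalEquality using (_≡_)
open import Relation.Binary.Construct.Closure.ReflexiveTransitive using (Star)

Name : Set
Name = ℕ

data Vis : Set where
  nm : Name → Vis
  co : Name → Vis

visName : Vis → Name
visName (nm a) = a
visName (co a) = a

bar : Vis → Vis
bar (nm a) = co a
bar (co a) = nm a

data Act : Set where
  vis : Vis → Act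
  τ   : Act

-- Finite sets of visible actions (priority guards), represented as lists
Guard : Set
Guard = List Vis

barSet : Guard → Guard
barSet = map bar

relVis : (Name → Name) → Vis → Vis
relVis f (nm a) = nm (f a)
relVis f (co a) = co (f a)

relAct : (Name → Name) → Act → Act
relAct f (vis v) = vis (relVis f v)
relAct f τ       = τ

restrictGuard : List Name → Guard → Guard
restrictGuard L = filter (λ v → ¬? (visName v ∈? L))

Allowed : List Name → Act → Set
Allowed L (vis v) = visName v ∉ L
Allowed L τ       = Data.Unit.⊤
  where import Data.Unit

-- CPG process syntax (recursion-free fragment)
mutual
  data Proc : Set where
    𝟘    : Proc
    sum  : List Branch → Proc
    _[_] : Proc → (Name → Name) → Proc
    _∖_  : Proc → List Name → Proc
    _∣_  : Proc → Proc → Proc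

  record Branch : Set where
    inductive
    constructor br
    field
      guard : Guard
      act   : Act
      cont  : Proc

open Branch public

record Label : Set where
  constructor _⦂_
  field
    lguard : Guard
    lact   : Act

open Label public

-- Labelled transition relation (Phillips' rules), defined by structural
-- recursion on the source process; the negative premises of the Par and
-- React rules refer to transitions of strict subterms (stratification).
mutual
  Step : Proc → Label → Proc → Set
  Step 𝟘 l R = ⊥
  Step (sum bs) (S ⦂ μ) R =
    Any (λ b → (S ≡ guard b) × (μ ≡ act b) × (R ≡ cont b)) bs
  Step (P [ f ]) (S' ⦂ μ') R =
    Σ Guard λ S → Σ Act λ μ → Σ Proc λ P' →
      Step P (S ⦂ μ) P' × (S' ≡ map (relVis f) S) × (μ' ≡ relAct f μ) × (R ≡ P' [ f ])
  Step (P ∖ L) (S' ⦂ μ) R =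
    Σ Guard λ S → Σ Proc λ P' →
      Step P (S ⦂ μ) P' × Allowed L μ × (S' ≡ restrictGuard L S) × (R ≡ P' ∖ L)
  Step (P ∣ Q) (S ⦂ μ) R =
      (Σ Proc λ P' → Step P (S ⦂ μ) P' × NoOffer Q (barSet S) × (R ≡ P' ∣ Q))
    ⊎ (Σ Proc λ Q' → Step Q (S ⦂ μ) Q' × NoOffer P (barSet S) × (R ≡ P ∣ Q'))
    ⊎ (Σ Vis λ α → Σ Guard λ S₁ → Σ Guard λ S₂ → Σ Proc λ P' → Σ Proc λ Q' →
         Step P (S₁ ⦂ vis α) P' × Step Q (S₂ ⦂ vis (bar α)) Q'
         × NoOffer P (barSet S₂) × NoOffer Q (barSet S₁)
         × (S ≡ S₁ ++ S₂) × (μ ≡ τ) × (R ≡ P' ∣ Q'))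

  NoOffer : Proc → Guard → Set
  NoOffer P X = ∀ T β P' → β ∈ X → ¬ Step P (T ⦂ vis β) P'

_—τ→_ : Proc → Proc → Set
P —τ→ P' = Σ Guard λ S → Step P (S ⦂ τ) P'

_⇒_ : Proc → Proc → Set
_⇒_ = Star _—τ→_

_⇓ : Proc → Set
P ⇓ = Σ Proc λ P' → Σ Guard λ S → Σ Vis λ α → Σ Proc λ P'' →
        (P ⇒ P') × Step P' (S ⦂ vis α) P''

Invisible : Proc → Set
Invisible P = ¬ (P ⇓)

mutual
  data _∈fn_ (a : Name) : Proc → Set where
    fn-sum : ∀ {bs} → Any (a ∈fnB_) bs → a ∈fn sum bs
    fn-rel : ∀ {P f b} → b ∈fn P → f b ≡ a → a ∈fn (P [ f ])
    fn-res : ∀ {P L} → a ∈fn P → a ∉ L → a ∈fn (P ∖ L)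
    fn-parL : ∀ {P Q} → a ∈fn P → a ∈fn (P ∣ Q)
    fn-parR : ∀ {P Q} → a ∈fn Q → a ∈fn (P ∣ Q)

  data _∈fnB_ (a : Name) : Branch → Set where
    fnb-guard : ∀ {S μ P} → Any (λ v → visName v ≡ a) S → a ∈fnB br S μ P
    fnb-act   : ∀ {S v P} → visName v ≡ a → a ∈fnB br S (vis v) P
    fnb-cont  : ∀ {S μ P} → a ∈fn P → a ∈fnB br S μ P

Closed : Proc → Set
Closed P = ∀ a → ¬ (a ∈fn P)

data Ctx : Set where
  ●     : Ctx
  sumC  : List Branch → Guard → Act → Ctx → List Branch → Ctx
  relC  : Ctx → (Name → Name) → Ctx
  resC  : Ctx → List Name → Ctx
  parLC : Ctx → Proc → Ctx
  parRC : Proc → Ctx → Ctx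

_⟦_⟧ : Ctx → Proc → Proc
● ⟦ P ⟧ = P
sumC bs₁ S μ C bs₂ ⟦ P ⟧ = sum (bs₁ ++ (br S μ (C ⟦ P ⟧) ∷ bs₂))
relC C f ⟦ P ⟧ = (C ⟦ P ⟧) [ f ]
resC C L ⟦ P ⟧ = (C ⟦ P ⟧) ∖ L
parLC C Q ⟦ P ⟧ = (C ⟦ P ⟧) ∣ Q
parRC Q C ⟦ P ⟧ = Q ∣ (C ⟦ P ⟧)

ReplacementFree : Set
ReplacementFree = ∀ (C : Ctx) (I P : Proc) → Closed I → Invisible I → C ⟦ I ⟧ ⇓ → C ⟦ P ⟧ ⇓

-- The guard of  {ā}:b.0  forbids b whenever the environment offers a.  In
-- (({ā}:b.0) ∣ [·]) ∖ {a} the invisible 0 offers nothing, so b is observable;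
-- replacing 0 by a.0 disables b, while a itself is restricted away and has no
-- partner ā, so the whole process is stuck.
module Submission where

open import Defs
open import Data.Product using (Σ; _×_; _,_)
open import Data.List using (List; []; _∷_)
open import Data.List.Membership.Propositional using (_∈_)
open import Data.List.Relation.Unary.Any using (here; there)
open import Data.Sum using (inj₁; inj₂)
open import Data.Empty using (⊥-elim)
open import Relation.Nullary using (¬_)
open import Relation.Binary.PropositionalEquality using (_≡_; refl)
open import Relation.Binary.Construct.Closure.ReflexiveTransitive using (ε; _◅_)

Stuck : Proc → Set
Stuck P = ∀ l R → ¬ Step P l R

stuck⇒invisible : ∀ {P} → Stuck P → Invisible P
stuck⇒invisible stuck (_ , _ , _ , _ , ε , step)           = stuck _ _ step
stuck⇒invisible stuck (_ , _ , _ , _ , (_ , step) ◅ _ , _) = stuck _ _ step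

𝟘-stuck : Stuck 𝟘
𝟘-stuck _ _ ()

𝟘-closed : Closed 𝟘
𝟘-closed _ ()

𝟘-noOffer : ∀ X → NoOffer 𝟘 X
𝟘-noOffer _ _ _ _ _ ()

restriction-stuck : ∀ {P L a} → a ∈ L →
                    (∀ {S μ R} → Step P (S ⦂ μ) R → μ ≡ vis (nm a)) →
                    Stuck (P ∖ L)
restriction-stuck a∈L onlyA (_ ⦂ _) _ (_ , _ , step , allowed , _) with onlyA step
... | refl = allowed a∈L

prefix : Guard → Act → Proc → Proc
prefix S μ P = sum (br S μ P ∷ [])

prefix-step : ∀ S μ P → Step (prefix S μ P) (S ⦂ μ) P
prefix-step _ _ _ = here (refl , refl , refl)

prefix-step-inv : ∀ {S μ P T ν R} → Step (prefix S μ P) (T ⦂ ν) R →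
                  T ≡ S × ν ≡ μ × R ≡ P
prefix-step-inv (here eqs) = eqs

a b : Name
a = 0
b = 1

offer-a : Proc
offer-a = prefix [] (vis (nm a)) 𝟘

b-unless-a : Proc
b-unless-a = prefix (co a ∷ []) (vis (nm b)) 𝟘

observer : Ctx
observer = resC (parRC b-unless-a ●) (a ∷ [])

b-unless-a∣offer-a-only-a : ∀ {S μ R} → Step (b-unless-a ∣ offer-a) (S ⦂ μ) R →
                            μ ≡ vis (nm a)
b-unless-a∣offer-a-only-a (inj₁ (_ , step , noA , _)) with prefix-step-inv step
... | refl , refl , refl = ⊥-elim (noA _ _ _ (here refl) (prefix-step _ _ _))
b-unless-a∣offer-a-only-a (inj₂ (inj₁ (_ , step , _))) with prefix-step-inv step
... | _ , eq , _ = eq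
b-unless-a∣offer-a-only-a (inj₂ (inj₂ (_ , _ , _ , _ , _ , stepB , stepA , _)))
  with prefix-step-inv stepB | prefix-step-inv stepA
... | _ , refl , _ | _ , () , _

observer-sees-b-with-𝟘 : observer ⟦ 𝟘 ⟧ ⇓
observer-sees-b-with-𝟘 =
  _ , _ , nm b , _ , ε ,
  (_ , _ , inj₁ (_ , prefix-step _ _ _ , 𝟘-noOffer _ , refl) ,
   (λ { (here ()) ; (there ()) }) , refl , refl)

observer-stuck-with-offer-a : Stuck (observer ⟦ offer-a ⟧)
observer-stuck-with-offer-a = restriction-stuck (here refl) b-unless-a∣offer-a-only-a

proposition5p2 : Σ Ctx λ C → Σ Proc λ I → Σ Proc λ P → Closed I × Invisible I × (C ⟦ I ⟧ ⇓) × ¬ (C ⟦ P ⟧ ⇓)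
proposition5p2 =
  observer , 𝟘 , offer-a ,
  𝟘-closed , stuck⇒invisible 𝟘-stuck ,
  observer-sees-b-with-𝟘 , stuck⇒invisible observer-stuck-with-offer-a
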